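{- There exist infinitely many permutations of $\mathbb{N}$ (bijections $\mathbb{N}\to\mathbb{N}$) any two distinct of which are infinitely colliding: for any two distinct ones $x=(x_1,x_2,\dots)$ and $y=(y_1,y_2,\dots)$, there are infinitely many positions $n$ with $|x_n-y_n|=1$.
   Context: An infinite permutation is a bijection $x:\mathbb{N}\to\mathbb{N}$, written as the sequence $(x_1,x_2,\dots)$ with $x_n$ the entry in position $n$. Two infinite permutations are infinitely colliding if in infinitely many positions their entries are consecutive integers. -}

module Defs where

open import Data.Nat using (ℕ; suc; _≤_)
open import Data.Product using (∃; _×_)
open import Data.Sum using (_⊎_)
open import Relation.Binary.PropositionalEquality using (_≡_)
open import Function.Bundles using (_↔_; Inverse)

Perm : Set
Perm = ℕ ↔ ℕ

_⟨_⟩ : Perm → ℕ → ℕ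
x ⟨ n ⟩ = Inverse.to x n

Consecutive : ℕ → ℕ → Set
Consecutive a b = (a ≡ suc b) ⊎ (b ≡ suc a)

InfinitelyColliding : Perm → Perm → Set
InfinitelyColliding x y = ∀ N → ∃ λ n → N ≤ n × Consecutive (x ⟨ n ⟩) (y ⟨ n ⟩)

module Submission where

-- Split ℕ into the blocks {2k, 2k+1}.  Every Boolean sequence
-- f : ℕ → Bool determines an involution of ℕ that swaps the block {2k, 2k+1}
-- exactly when f k is true.  If f and g disagree at k, the two involutions
-- send position 2k to 2k and 2k+1 respectively, i.e. to consecutive
-- integers.  So two such permutations collide infinitely often as soon as
-- their sequences disagree infinitely often.  It then suffices to exhibit
-- countably many Boolean sequences that pairwise disagree infinitely often:
-- take the binary digit sequences  k ↦ (i-th binary digit of k).  For l < m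
-- the numbers 2ᵐ(2N+1) ≥ N have digit 1 in place m and digit 0 in place l.

open import Defs
open import Data.Nat using (ℕ; zero; suc; _≤_; _<_; z≤n; s≤s; ⌊_/2⌋)
open import Data.Nat.Properties using (≤-refl; ≤-trans; m≤n⇒m≤1+n; <-cmp; 1+n≢n)
open import Data.Bool using (Bool; true; false; if_then_else_)
open import Data.Product using (∃; _×_; _,_)
open import Data.Sum using (inj₁; inj₂)
open import Relation.Nullary using (¬_; contradiction)
open import Relation.Binary using (tri<; tri≈; tri>)
open import Relation.Binary.PropositionalEquality
  using (_≡_; _≢_; refl; cong; sym; trans; ≢-sym)
open import Function.Bundles using (mk↔ₛ′)

-- Doubling and parity, by recursion so that they compute on numerals
-- and match the halving ⌊_/2⌋ of the library.

double : ℕ → ℕ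
double zero    = zero
double (suc n) = suc (suc (double n))

odd : ℕ → Bool
odd 0             = false
odd 1             = true
odd (suc (suc n)) = odd n

half-double : ∀ n → ⌊ double n /2⌋ ≡ n
half-double zero    = refl
half-double (suc n) = cong suc (half-double n)

odd-double : ∀ n → odd (double n) ≡ false
odd-double zero    = refl
odd-double (suc n) = odd-double n

odd-suc-double : ∀ n → odd (suc (double n)) ≡ true
odd-suc-double zero    = refl
odd-suc-double (suc n) = odd-suc-double n

n≤double : ∀ n → n ≤ double n
n≤double zero    = z≤n
n≤double (suc n) = s≤s (m≤n⇒m≤1+n (n≤double n))

swapPairs : (ℕ → Bool) → ℕ → ℕ
swapPairs f 0             = if f 0 then 1 else 0
swapPairs f 1             = if f 0 then 0 else 1
swapPairs f (suc (suc n)) = suc (suc (swapPairs (λ k → f (suc k)) n))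

swapPairs-involutive : ∀ f n → swapPairs f (swapPairs f n) ≡ n
swapPairs-involutive f 0 with f 0 in e
... | true  rewrite e = refl
... | false rewrite e = refl
swapPairs-involutive f 1 with f 0 in e
... | true  rewrite e = refl
... | false rewrite e = refl
swapPairs-involutive f (suc (suc n)) =
  cong (λ m → suc (suc m)) (swapPairs-involutive (λ k → f (suc k)) n)

swapPerm : (ℕ → Bool) → Perm
swapPerm f = mk↔ₛ′ (swapPairs f) (swapPairs f)
  (swapPairs-involutive f) (swapPairs-involutive f)

stepIf : Bool → ℕ → ℕ
stepIf b n = if b then suc n else n

stepIf-suc-suc : ∀ b n → suc (suc (stepIf b n)) ≡ stepIf b (suc (suc n))
stepIf-suc-suc true  n = refl
stepIf-suc-suc false n = refl

swapPairs-double : ∀ f k → swapPairs f (double k) ≡ stepIf (f k) (double k)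
swapPairs-double f zero    = refl
swapPairs-double f (suc k) =
  trans (cong (λ m → suc (suc m)) (swapPairs-double (λ j → f (suc j)) k))
        (stepIf-suc-suc (f (suc k)) (double k))

stepIf-consecutive : ∀ {b c} n → b ≢ c → Consecutive (stepIf b n) (stepIf c n)
stepIf-consecutive {true}  {true}  n b≢c = contradiction refl b≢c
stepIf-consecutive {true}  {false} n b≢c = inj₁ refl
stepIf-consecutive {false} {true}  n b≢c = inj₂ refl
stepIf-consecutive {false} {false} n b≢c = contradiction refl b≢c

InfinitelyDisagreeing : (ℕ → Bool) → (ℕ → Bool) → Set
InfinitelyDisagreeing f g = ∀ N → ∃ λ k → N ≤ k × f k ≢ g k

InfinitelyDisagreeing-sym : ∀ {f g} →
  InfinitelyDisagreeing f g → InfinitelyDisagreeing g f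
InfinitelyDisagreeing-sym d N with d N
... | k , N≤k , fk≢gk = k , N≤k , ≢-sym fk≢gk

-- A disagreement at k is a collision at position 2k.
disagreeing⇒colliding : ∀ {f g} →
  InfinitelyDisagreeing f g → InfinitelyColliding (swapPerm f) (swapPerm g)
disagreeing⇒colliding {f} {g} d N with d N
... | k , N≤k , fk≢gk = double k , ≤-trans N≤k (n≤double k) , collision
  where
  collision : Consecutive (swapPairs f (double k)) (swapPairs g (double k))
  collision rewrite swapPairs-double f k | swapPairs-double g k =
    stepIf-consecutive (double k) fk≢gk

consecutive⇒≢ : ∀ {a b} → Consecutive a b → a ≢ b
consecutive⇒≢ (inj₁ a≡1+b) a≡b = 1+n≢n (trans (sym a≡1+b) a≡b)
consecutive⇒≢ (inj₂ b≡1+a) a≡b = 1+n≢n (trans (sym b≡1+a) (sym a≡b))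

bit : ℕ → ℕ → Bool
bit zero    k = odd k
bit (suc i) k = bit i ⌊ k /2⌋

scale : ℕ → ℕ → ℕ
scale zero    y = y
scale (suc m) y = double (scale m y)

y≤scale : ∀ m y → y ≤ scale m y
y≤scale zero    y = ≤-refl
y≤scale (suc m) y = ≤-trans (y≤scale m y) (n≤double (scale m y))

bit-scale-same : ∀ m y → bit m (scale m y) ≡ odd y
bit-scale-same zero    y = refl
bit-scale-same (suc m) y rewrite half-double (scale m y) = bit-scale-same m y

bit-scale-below : ∀ l m y → l < m → bit l (scale m y) ≡ false
bit-scale-below zero    (suc m) y _         = odd-double (scale m y)
bit-scale-below (suc l) (suc m) y (s≤s l<m)
  rewrite half-double (scale m y) = bit-scale-below l m y l<m

-- For l < m, the digit sequences differ at every 2ᵐ(2N+1), which is ≥ N.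
bits-disagree : ∀ l m → l < m → InfinitelyDisagreeing (bit l) (bit m)
bits-disagree l m l<m N =
  scale m y , ≤-trans (m≤n⇒m≤1+n (n≤double N)) (y≤scale m y) , digits-differ
  where
  y : ℕ
  y = suc (double N)
  digits-differ : bit l (scale m y) ≢ bit m (scale m y)
  digits-differ rewrite bit-scale-below l m y l<m
                      | bit-scale-same m y | odd-suc-double N = λ ()

distinct-bits-disagree : ∀ i j → i ≢ j → InfinitelyDisagreeing (bit i) (bit j)
distinct-bits-disagree i j i≢j with <-cmp i j
... | tri< i<j _ _ = bits-disagree i j i<j
... | tri≈ _ i≡j _ = contradiction i≡j i≢j
... | tri> _ _ j<i = InfinitelyDisagreeing-sym (bits-disagree j i j<i)

theorem2 : ∃ λ (P : ℕ → Perm) →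
    (∀ i j → ¬ i ≡ j → ¬ (∀ n → P i ⟨ n ⟩ ≡ P j ⟨ n ⟩))
    × (∀ i j → ¬ i ≡ j → InfinitelyColliding (P i) (P j))
theorem2 = P , distinct , colliding
  where
  P : ℕ → Perm
  P i = swapPerm (bit i)

  colliding : ∀ i j → i ≢ j → InfinitelyColliding (P i) (P j)
  colliding i j i≢j = disagreeing⇒colliding (distinct-bits-disagree i j i≢j)

  -- a single collision already separates the two permutations
  distinct : ∀ i j → i ≢ j → ¬ (∀ n → P i ⟨ n ⟩ ≡ P j ⟨ n ⟩)
  distinct i j i≢j same with colliding i j i≢j 0
  ... | n , _ , consecutive = consecutive⇒≢ consecutive (same n)
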